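{- Let $\mathcal C$ be a class of formulas closed under disjunction, let $k\ge 0$, and let $L$ be a regular language with syntactic monoid $M$. If $\mathrm{Member}(M)\in k\text{ -ary }\mathrm{Dyn}\mathcal C$, then $\mathrm{Member}(L)\in k\text{ -ary }\mathrm{Dyn}\mathcal C$.
   Context: Dynamic descriptive complexity: a word $w_1\cdots w_n$ over $\Sigma\cup\{\epsilon\}$ is encoded on domain $\{1,\dots,n\}$ with unary relations $W_\sigma$ (each position in at most one) and the order $\le$; changes $\mathrm{set}_\sigma(i)$ set position $i$ to $\sigma\in\Sigma\cup\{\epsilon\}$. A dynamic program has, for each auxiliary relation $R$ and each $\sigma$, an update formula $\varphi^R_\sigma(\bar x;y)$; after $\mathrm{set}_\sigma(i)$ the new $R$ is the set of tuples satisfying $\varphi^R_\sigma(\cdot;i)$ in (changed word, old auxiliary relations); initially the word is $\epsilon^n$ and auxiliary relations are first-order definable. $\mathrm{Member}(L)$ is maintained if a distinguished $0$-ary relation is true iff the current word (concatenation of non-$\epsilon$ symbols) is in $L$. $k$-ary $\mathrm{Dyn}\mathcal C$: problems maintainable with auxiliary relations of arity $\le k$ and update formulas in $\mathcal C$ (first-order initialization). For a finite monoid $M$, $\mathrm{Member}(M)$ is the problem over alphabet $M$ (with $\epsilon$ identified with the identity of $M$) of maintaining, for each $x\in M$, a $0$-ary relation true iff the product $w_1\cdots w_n$ in $M$ equals $x$. The syntactic monoid of $L$ is the transition monoid of its minimal deterministic automaton. -}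

module Defs where

open import Data.Nat using (ℕ; zero; suc; _≤_)
open import Data.Fin as Fin using (Fin; _≟_)
open import Data.List as List using (List; []; _∷_; length; foldr; foldl; catMaybes; tabulate; map)
open import Data.List.Relation.Unary.All using (All)
open import Data.Vec as Vec using (Vec)
open import Data.Maybe using (Maybe; just; nothing)
import Data.Maybe as Maybe
open import Data.Product using (Σ; ∃; _×_; _,_)
open import Data.Sum using (_⊎_)
open import Data.Unit using (⊤)
open import Data.Empty using (⊥)
open import Data.Bool using (Bool)
open import Relation.Nullary using (¬_; yes; no)
open import Relation.Binary.PropositionalEquality using (_≡_; _≢_; subst; sym)
open import Function.Bundles using (_⇔_)
open import Algebra.Structures using (IsMonoid)

-- First-order formulas over the vocabulary of a dynamic program:
--   * word relations W_a for letters a : Fin s   (unary)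
--   * the order ≤ and equality
--   * auxiliary relation symbols r : Fin (length τ) of arity lookup τ r
-- Variables are de Bruijn indices Fin Γ (variable zero = innermost bound).

data Fm (s : ℕ) (τ : List ℕ) : ℕ → Set where
  W    : ∀ {Γ} → Fin s → Fin Γ → Fm s τ Γ
  le   : ∀ {Γ} → Fin Γ → Fin Γ → Fm s τ Γ
  eq   : ∀ {Γ} → Fin Γ → Fin Γ → Fm s τ Γ
  R    : ∀ {Γ} (r : Fin (length τ)) → Vec (Fin Γ) (List.lookup τ r) → Fm s τ Γ
  ‵⊤   : ∀ {Γ} → Fm s τ Γ
  ‵⊥   : ∀ {Γ} → Fm s τ Γ
  ‵¬   : ∀ {Γ} → Fm s τ Γ → Fm s τ Γ
  _‵∧_ : ∀ {Γ} → Fm s τ Γ → Fm s τ Γ → Fm s τ Γ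
  _‵∨_ : ∀ {Γ} → Fm s τ Γ → Fm s τ Γ → Fm s τ Γ
  ‵∃   : ∀ {Γ} → Fm s τ (suc Γ) → Fm s τ Γ
  ‵∀   : ∀ {Γ} → Fm s τ (suc Γ) → Fm s τ Γ

⋁ : ∀ {s τ Γ} → List (Fm s τ Γ) → Fm s τ Γ
⋁ = foldr _‵∨_ ‵⊥

-- Structures on the domain Fin n (positions 1..n, ordered), encoding a word
-- over Σ ∪ {ε}: word i = nothing means position i carries ε.
record Structure (n s : ℕ) (τ : List ℕ) : Set₁ where
  field
    word : Fin n → Maybe (Fin s)
    rel  : (r : Fin (length τ)) → Vec (Fin n) (List.lookup τ r) → Set
open Structure public

Sat : ∀ {n s τ Γ} → Structure n s τ → Fm s τ Γ → Vec (Fin n) Γ → Set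
Sat 𝔄 (W a x)   ρ = word 𝔄 (Vec.lookup ρ x) ≡ just a
Sat 𝔄 (le x y)  ρ = Vec.lookup ρ x Fin.≤ Vec.lookup ρ y
Sat 𝔄 (eq x y)  ρ = Vec.lookup ρ x ≡ Vec.lookup ρ y
Sat 𝔄 (R r v)   ρ = rel 𝔄 r (Vec.map (Vec.lookup ρ) v)
Sat 𝔄 ‵⊤        ρ = ⊤
Sat 𝔄 ‵⊥        ρ = ⊥
Sat 𝔄 (‵¬ φ)    ρ = ¬ Sat 𝔄 φ ρ
Sat 𝔄 (φ ‵∧ ψ)  ρ = Sat 𝔄 φ ρ × Sat 𝔄 ψ ρ
Sat 𝔄 (φ ‵∨ ψ)  ρ = Sat 𝔄 φ ρ ⊎ Sat 𝔄 ψ ρ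
Sat {n} 𝔄 (‵∃ φ) ρ = Σ (Fin n) λ a → Sat 𝔄 φ (a Vec.∷ ρ)
Sat {n} 𝔄 (‵∀ φ) ρ = (a : Fin n) → Sat 𝔄 φ (a Vec.∷ ρ)

wordOf : ∀ {n s} → (Fin n → Maybe (Fin s)) → List (Fin s)
wordOf w = catMaybes (tabulate w)

-- Dynamic programs over alphabet Fin s.
-- upd r σ : update formula φ^R_σ(x̄ ; y); in the environment, y is
--           variable zero and x̄ are the variables 1 .. arity.
-- ini r   : first-order initialization formula, evaluated on the initial
--           structure ε^n with the order (no auxiliary symbols).
record DynProg (s : ℕ) : Set where
  field
    τ   : List ℕ
    upd : (r : Fin (length τ)) → Maybe (Fin s) → Fm s τ (suc (List.lookup τ r))
    ini : (r : Fin (length τ)) → Fm s [] (List.lookup τ r)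
open DynProg public

setW : ∀ {n s} → Fin n → Maybe (Fin s) → (Fin n → Maybe (Fin s)) → (Fin n → Maybe (Fin s))
setW i σ w j with j ≟ i
... | yes _ = σ
... | no  _ = w j

emptyStruct : ∀ {n s} → Structure n s []
emptyStruct = record { word = λ _ → nothing ; rel = λ () }

initState : ∀ {n s} (P : DynProg s) → Structure n s (τ P)
initState P = record
  { word = λ _ → nothing
  ; rel  = λ r v → Sat emptyStruct (ini P r) v }

step : ∀ {n s} (P : DynProg s) → Structure n s (τ P) → Fin n × Maybe (Fin s) → Structure n s (τ P)
step P 𝔄 (i , σ) = record
  { word = setW i σ (word 𝔄)
  ; rel  = λ r x̄ → Sat 𝔄′ (upd P r σ) (i Vec.∷ x̄) }
  where
  𝔄′ : Structure _ _ (τ P)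
  𝔄′ = record { word = setW i σ (word 𝔄) ; rel = rel 𝔄 }

run : ∀ {n s} (P : DynProg s) → List (Fin n × Maybe (Fin s)) → Structure n s (τ P)
run P cs = foldl (step P) (initState P) cs

holds0 : ∀ {n s τ} → Structure n s τ → (r : Fin (length τ)) → List.lookup τ r ≡ 0 → Set
holds0 {n} 𝔄 r p = rel 𝔄 r (subst (Vec (Fin n)) (sym p) Vec.[])

FormulaClass : Set₁
FormulaClass = ∀ {s : ℕ} {τ : List ℕ} {Γ : ℕ} → Fm s τ Γ → Set

ClosedUnderDisjunction : FormulaClass → Set
ClosedUnderDisjunction C =
  (∀ {s τ Γ} → C (‵⊥ {s} {τ} {Γ})) ×
  (∀ {s τ Γ} {φ ψ : Fm s τ Γ} → C φ → C ψ → C (φ ‵∨ ψ))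

translate : ∀ {s s′ τ τ′ Γ} (f : Fin s → List (Fin s′)) (g : Fin (length τ) → Fin (length τ′)) →
            (∀ r → List.lookup τ′ (g r) ≡ List.lookup τ r) → Fm s τ Γ → Fm s′ τ′ Γ
translate f g pg (W a x)   = ⋁ (map (λ b → W b x) (f a))
translate f g pg (le x y)  = le x y
translate f g pg (eq x y)  = eq x y
translate {Γ = Γ} f g pg (R r v) = R (g r) (subst (Vec (Fin Γ)) (sym (pg r)) v)
translate f g pg ‵⊤        = ‵⊤
translate f g pg ‵⊥        = ‵⊥
translate f g pg (‵¬ φ)    = ‵¬ (translate f g pg φ)
translate f g pg (φ ‵∧ ψ)  = translate f g pg φ ‵∧ translate f g pg ψ
translate f g pg (φ ‵∨ ψ)  = translate f g pg φ ‵∨ translate f g pg ψ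
translate f g pg (‵∃ φ)    = ‵∃ (translate f g pg φ)
translate f g pg (‵∀ φ)    = ‵∀ (translate f g pg φ)

-- standing (implicit) property of a "class of formulas": it is defined
-- syntactically, uniformly in the vocabulary, hence closed under translation.
ClosedUnderTranslation : FormulaClass → Set
ClosedUnderTranslation C =
  ∀ {s s′ τ τ′ Γ} (f : Fin s → List (Fin s′)) (g : Fin (length τ) → Fin (length τ′))
    (pg : ∀ r → List.lookup τ′ (g r) ≡ List.lookup τ r) {φ : Fm s τ Γ} →
    C φ → C (translate {s} {s′} {τ} {τ′} {Γ} f g pg φ)

InDynClass : FormulaClass → ℕ → ∀ {s} → DynProg s → Set
InDynClass C k P = All (_≤ k) (τ P) × (∀ r σ → C (upd P r σ))

MaintainsMemberLang : ∀ {s} → DynProg s → (List (Fin s) → Set) → Set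
MaintainsMemberLang {s} P L =
  Σ (Fin (length (τ P))) λ d → Σ (List.lookup (τ P) d ≡ 0) λ p →
    ∀ n (cs : List (Fin n × Maybe (Fin s))) →
      holds0 (run P cs) d p ⇔ L (wordOf (word (run P cs)))

MemberLangInDyn : FormulaClass → ℕ → ∀ {s} → (List (Fin s) → Set) → Set
MemberLangInDyn C k {s} L = Σ (DynProg s) λ P → InDynClass C k P × MaintainsMemberLang P L

record FinMonoid : Set where
  field
    size     : ℕ
    _∙_      : Fin size → Fin size → Fin size
    e        : Fin size
    isMonoid : IsMonoid _≡_ _∙_ e

  mprod : List (Fin size) → Fin size
  mprod = foldr _∙_ e
open FinMonoid public

MaintainsMemberMonoid : (M : FinMonoid) → DynProg (size M) → Set
MaintainsMemberMonoid M P =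
  Σ (Fin (size M) → Fin (length (τ P))) λ acc → Σ (∀ x → List.lookup (τ P) (acc x) ≡ 0) λ p →
    ∀ n (cs : List (Fin n × Maybe (Fin (size M)))) (x : Fin (size M)) →
      holds0 (run P cs) (acc x) (p x) ⇔ (mprod M (wordOf (word (run P cs))) ≡ x)

MemberMonoidInDyn : FormulaClass → ℕ → FinMonoid → Set
MemberMonoidInDyn C k M = Σ (DynProg (size M)) λ P → InDynClass C k P × MaintainsMemberMonoid M P

record DFA (s : ℕ) : Set where
  field
    Q     : ℕ
    q₀    : Fin Q
    δ     : Fin Q → Fin s → Fin Q
    final : Fin Q → Bool

  δ* : Fin Q → List (Fin s) → Fin Q
  δ* = foldl δ
open DFA public

Recognizes : ∀ {s} → DFA s → (List (Fin s) → Set) → Set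
Recognizes A L = ∀ w → L w ⇔ (final A (δ* A (q₀ A) w) ≡ Bool.true)
  where import Data.Bool as Bool

IsMinimal : ∀ {s} → DFA s → Set
IsMinimal A =
  (∀ q → ∃ λ w → δ* A (q₀ A) w ≡ q) ×
  (∀ p q → p ≢ q → ∃ λ w → final A (δ* A p w) ≢ final A (δ* A q w))

-- M is (isomorphic to) the transition monoid {δ*(-,u) | u} of the minimal DFA
-- of L: the letter assignment h extends to a surjective morphism
-- Σ* → M whose kernel is exactly equality of induced state maps.
IsSyntacticMonoidOf : ∀ {s} → FinMonoid → (List (Fin s) → Set) → Set
IsSyntacticMonoidOf {s} M L =
  Σ (DFA s) λ A → Recognizes A L × IsMinimal A ×
  Σ (Fin s → Fin (size M)) λ h →
    (∀ x → ∃ λ u → mprod M (map h u) ≡ x) ×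
    (∀ u v → (mprod M (map h u) ≡ mprod M (map h v)) ⇔ (∀ q → δ* A q u ≡ δ* A q v))

-- Pull the dynamic program for Member(M) back along the letter map h : Σ → M of the syntactic
-- morphism: a letter atom W_m(x) becomes the disjunction of the W_a(x) with h a = m, so on a word
-- over Σ the pulled-back program maintains exactly the auxiliary relations the original one
-- maintains on the image of the word under h. As M recognises L through h, a word is in L iff its
-- image multiplies to an accepting element x, i.e. iff one of the 0-ary relations for accepting x
-- holds; their disjunction is maintained by one extra 0-ary relation whose update formula is the
-- disjunction of theirs, which is where closure under disjunction is needed.

module Submission where

open import Defs
open import Data.Nat using (ℕ; suc; z≤n)
open import Data.Fin as Fin using (Fin; _≟_)
open import Data.List as List using (List; []; _∷_; length; foldl; catMaybes; tabulate; map; filter; allFin)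
open import Data.List.Properties using (tabulate-cong; map-tabulate; map-catMaybes)
open import Data.List.Relation.Unary.All using (_∷_)
open import Data.List.Relation.Unary.Any using (Any)
open import Data.List.Relation.Unary.Any.Properties using (Any-cong; ∷↔; map↔)
open import Data.List.Membership.Propositional using (_∈_; find; lose)
open import Data.List.Membership.Propositional.Properties using (∈-filter⁺; ∈-filter⁻; ∈-allFin)
open import Data.Vec as Vec using (Vec)
open import Data.Maybe as Maybe using (Maybe; just; nothing)
open import Data.Maybe.Properties using (just-injective)
open import Data.Product using (Σ; ∃; _×_; _,_; proj₁; proj₂; map₂)
open import Data.Product.Function.NonDependent.Propositional using (_×-⇔_)
open import Data.Product.Function.Dependent.Propositional using (congˡ)
open import Data.Sum.Function.Propositional using (_⊎-⇔_)
open import Data.Bool as Bool using (Bool; true)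
open import Function using (_∘_)
open import Function.Bundles using (_⇔_; mk⇔; Equivalence)
open import Function.Construct.Composition using (_⇔-∘_)
open import Function.Construct.Identity using (⇔-id)
open import Function.Construct.Symmetry using (⇔-sym)
open import Function.Properties.Inverse using (↔⇒⇔)
open import Function.Related.Propositional using (equivalence; K-reflexive; module EquationalReasoning)
open import Function.Related.TypeIsomorphisms using (¬-cong-⇔)
open import Relation.Binary.PropositionalEquality
  using (_≡_; refl; sym; trans; cong; subst; _≗_; module ≡-Reasoning)
open import Relation.Binary.PropositionalEquality.Properties using (subst-application′)
open import Relation.Nullary using (yes; no)

Sat-⋁ : ∀ {n s τ Γ} {A : Set} (𝔄 : Structure n s τ) (F : A → Fm s τ Γ) (xs : List A) ρ →
        Sat 𝔄 (⋁ (map F xs)) ρ ⇔ Any (λ x → Sat 𝔄 (F x) ρ) xs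
Sat-⋁ 𝔄 F []       ρ = mk⇔ (λ ()) (λ ())
Sat-⋁ 𝔄 F (x ∷ xs) ρ = ↔⇒⇔ (∷↔ _) ⇔-∘ (⇔-id _ ⊎-⇔ Sat-⋁ 𝔄 F xs ρ)

⋁-closed : ∀ {C : FormulaClass} → ClosedUnderDisjunction C →
           ∀ {s τ Γ} {A : Set} (F : A → Fm s τ Γ) (xs : List A) → (∀ x → C (F x)) → C (⋁ (map F xs))
⋁-closed (⊥∈C , _)         F []       F∈C = ⊥∈C
⋁-closed C∨@(_ , ∨-closed) F (x ∷ xs) F∈C = ∨-closed (F∈C x) (⋁-closed C∨ F xs F∈C)

castArity : ∀ {s τ m m′} → m ≡ m′ → Fm s τ (suc m) → Fm s τ (suc m′)
castArity {s} {τ} = subst (λ m → Fm s τ (suc m))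

castArity-closed : (C : FormulaClass) → ∀ {s τ m m′} (e : m ≡ m′) {φ : Fm s τ (suc m)} →
                   C φ → C (castArity e φ)
castArity-closed C refl φ∈C = φ∈C

Sat-castArity : ∀ {n s τ m m′} (𝔄 : Structure n s τ) (e : m ≡ m′) φ i xs →
                Sat 𝔄 (castArity e φ) (i Vec.∷ xs) ≡ Sat 𝔄 φ (i Vec.∷ subst (Vec (Fin n)) (sym e) xs)
Sat-castArity 𝔄 refl φ i xs = refl

Sat-subst : ∀ {n s τ Γ Δ} (𝔄 : Structure n s τ) (e : Γ ≡ Δ) φ ρ →
            Sat 𝔄 (subst (Fm s τ) e φ) ρ ≡ Sat 𝔄 φ (subst (Vec (Fin n)) (sym e) ρ)
Sat-subst 𝔄 refl φ ρ = refl

module _ {n s s′ τ τ′} (f : Fin s → List (Fin s′)) (g : Fin (length τ) → Fin (length τ′))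
         (pg : ∀ r → List.lookup τ′ (g r) ≡ List.lookup τ r)
         (𝔄′ : Structure n s′ τ′) (𝔄 : Structure n s τ)
         (word-⇔ : ∀ j a → Any (λ b → word 𝔄′ j ≡ just b) (f a) ⇔ (word 𝔄 j ≡ just a))
         (rel-⇔ : ∀ r v → rel 𝔄′ (g r) (subst (Vec (Fin n)) (sym (pg r)) v) ⇔ rel 𝔄 r v)
         where

  Sat-translate : ∀ {Γ} (φ : Fm s τ Γ) ρ → Sat 𝔄′ (translate f g pg φ) ρ ⇔ Sat 𝔄 φ ρ
  Sat-translate (W a x)  ρ = word-⇔ _ a ⇔-∘ Sat-⋁ 𝔄′ (λ b → W b x) (f a) ρ
  Sat-translate (le x y) ρ = ⇔-id _
  Sat-translate (eq x y) ρ = ⇔-id _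
  Sat-translate {Γ} (R r v) ρ =
    subst (λ u → rel 𝔄′ (g r) u ⇔ _)
          (subst-application′ (Vec (Fin Γ)) (λ _ → Vec.map (Vec.lookup ρ)) (sym (pg r)))
          (rel-⇔ r (Vec.map (Vec.lookup ρ) v))
  Sat-translate ‵⊤       ρ = ⇔-id _
  Sat-translate ‵⊥       ρ = ⇔-id _
  Sat-translate (‵¬ φ)   ρ = ¬-cong-⇔ (Sat-translate φ ρ)
  Sat-translate (φ ‵∧ ψ) ρ = Sat-translate φ ρ ×-⇔ Sat-translate ψ ρ
  Sat-translate (φ ‵∨ ψ) ρ = Sat-translate φ ρ ⊎-⇔ Sat-translate ψ ρ
  Sat-translate (‵∃ φ)   ρ = congˡ {k = equivalence} λ {a} → Sat-translate φ (a Vec.∷ ρ)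
  Sat-translate (‵∀ φ)   ρ = mk⇔ (λ sat a → Equivalence.to   (Sat-translate φ (a Vec.∷ ρ)) (sat a))
                                 (λ sat a → Equivalence.from (Sat-translate φ (a Vec.∷ ρ)) (sat a))

preimage : ∀ {s t} → (Fin s → Fin t) → Fin t → List (Fin s)
preimage {s} h a = filter (λ b → h b ≟ a) (allFin s)

preimage-just : ∀ {s t} (h : Fin s → Fin t) (m : Maybe (Fin s)) (a : Fin t) →
                Any (λ b → m ≡ just b) (preimage h a) ⇔ (Maybe.map h m ≡ just a)
preimage-just {s} h m a = mk⇔ (to m) (from m)
  where
  to : ∀ m → Any (λ b → m ≡ just b) (preimage h a) → Maybe.map h m ≡ just a
  to m m≡b with find m≡b
  ... | b , b∈ , refl = cong just (proj₂ (∈-filter⁻ (λ b → h b ≟ a) {xs = allFin s} b∈))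

  from : ∀ m → Maybe.map h m ≡ just a → Any (λ b → m ≡ just b) (preimage h a)
  from (just b) hb≡a = lose (∈-filter⁺ (λ b → h b ≟ a) (∈-allFin b) (just-injective hb≡a)) refl

Nullary : ∀ {t} → DynProg t → Set
Nullary P = Σ (Fin (length (τ P))) λ r → List.lookup (τ P) r ≡ 0

module Pullback {s t} (h : Fin s → Fin t) (P : DynProg t) (flags : List (Nullary P)) where

  τ′ : List ℕ
  τ′ = 0 ∷ τ P

  pullUpd : ∀ {Γ} → Fm t (τ P) Γ → Fm s τ′ Γ
  pullUpd = translate (preimage h) Fin.suc (λ _ → refl)

  pullIni : ∀ {Γ} → Fm t [] Γ → Fm s [] Γ
  pullIni = translate (preimage h) (λ ()) (λ ())

  -- The flags are 0-ary only up to a propositional equality, hence the casts.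
  upd′ : (r : Fin (length τ′)) → Maybe (Fin s) → Fm s τ′ (suc (List.lookup τ′ r))
  upd′ Fin.zero    σ = ⋁ (map (λ (r , p) → pullUpd (castArity p (upd P r (Maybe.map h σ)))) flags)
  upd′ (Fin.suc r) σ = pullUpd (upd P r (Maybe.map h σ))

  ini′ : (r : Fin (length τ′)) → Fm s [] (List.lookup τ′ r)
  ini′ Fin.zero    = ⋁ (map (λ (r , p) → pullIni (subst (Fm t []) p (ini P r))) flags)
  ini′ (Fin.suc r) = pullIni (ini P r)

  pullback : DynProg s
  pullback = record { τ = τ′ ; upd = upd′ ; ini = ini′ }

  pullback-inDyn : (C : FormulaClass) → ClosedUnderDisjunction C → ClosedUnderTranslation C →
                   ∀ {k} → InDynClass C k P → InDynClass C k pullback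
  pullback-inDyn C C∨ Ctr (arities , upd∈C) = z≤n ∷ arities , upd′∈C
    where
    pullUpd-closed : ∀ {Γ} {φ : Fm t (τ P) Γ} → C φ → C (pullUpd φ)
    pullUpd-closed = Ctr (preimage h) Fin.suc (λ _ → refl)

    upd′∈C : ∀ r σ → C (upd′ r σ)
    upd′∈C Fin.zero    σ = ⋁-closed C∨ _ flags λ (r , p) →
                             pullUpd-closed (castArity-closed C p (upd∈C r (Maybe.map h σ)))
    upd′∈C (Fin.suc r) σ = pullUpd-closed (upd∈C r (Maybe.map h σ))

  pullChange : ∀ {n} → Fin n × Maybe (Fin s) → Fin n × Maybe (Fin t)
  pullChange = map₂ (Maybe.map h)

  record Simulates {n} (𝔄′ : Structure n s τ′) (𝔄 : Structure n t (τ P)) : Set where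
    field
      word-≗ : Maybe.map h ∘ word 𝔄′ ≗ word 𝔄
      rel-⇔  : ∀ r v → rel 𝔄′ (Fin.suc r) v ⇔ rel 𝔄 r v
      flag-⇔ : rel 𝔄′ Fin.zero Vec.[] ⇔ Any (λ (r , p) → holds0 𝔄 r p) flags
  open Simulates public

  Sat-pullUpd : ∀ {n} (𝔄′ : Structure n s τ′) (𝔄 : Structure n t (τ P)) →
                Maybe.map h ∘ word 𝔄′ ≗ word 𝔄 → (∀ r v → rel 𝔄′ (Fin.suc r) v ⇔ rel 𝔄 r v) →
                ∀ {Γ} (φ : Fm t (τ P) Γ) ρ → Sat 𝔄′ (pullUpd φ) ρ ⇔ Sat 𝔄 φ ρ
  Sat-pullUpd 𝔄′ 𝔄 word-≗ rel-⇔ = Sat-translate (preimage h) Fin.suc (λ _ → refl) 𝔄′ 𝔄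
    (λ j a → subst (λ m → _ ⇔ m ≡ just a) (word-≗ j) (preimage-just h (word 𝔄′ j) a)) rel-⇔

  Sat-pullIni : ∀ {n Γ} (φ : Fm t [] Γ) ρ → Sat {n} emptyStruct (pullIni φ) ρ ⇔ Sat emptyStruct φ ρ
  Sat-pullIni = Sat-translate (preimage h) (λ ()) (λ ()) emptyStruct emptyStruct
    (λ j a → preimage-just h nothing a) (λ ())

  initState-Simulates : ∀ {n} → Simulates (initState {n} pullback) (initState {n} P)
  initState-Simulates = record
    { word-≗ = λ _ → refl
    ; rel-⇔  = λ r → Sat-pullIni (ini P r)
    ; flag-⇔ = Any-cong {k = equivalence}
                 (λ (r , p) → K-reflexive (Sat-subst emptyStruct p (ini P r) Vec.[])
                              ⇔-∘ Sat-pullIni (subst (Fm t []) p (ini P r)) Vec.[])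
                 (⇔-id _)
               ⇔-∘ Sat-⋁ emptyStruct _ flags Vec.[]
    }

  step-Simulates : ∀ {n} {𝔄′ : Structure n s τ′} {𝔄 : Structure n t (τ P)} c →
                   Simulates 𝔄′ 𝔄 → Simulates (step pullback 𝔄′ c) (step P 𝔄 (pullChange c))
  step-Simulates {n} {𝔄′} {𝔄} (i , σ) sim = record
    { word-≗ = setW-≗
    ; rel-⇔  = λ r v → Sat-pull (upd P r σ′) (i Vec.∷ v)
    ; flag-⇔ = Any-cong {k = equivalence}
                 (λ (r , p) → K-reflexive (Sat-castArity 𝔅 p (upd P r σ′) i Vec.[])
                              ⇔-∘ Sat-pull (castArity p (upd P r σ′)) (i Vec.∷ Vec.[]))
                 (⇔-id _)
               ⇔-∘ Sat-⋁ 𝔅′ _ flags (i Vec.∷ Vec.[])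
    }
    where
    σ′ : Maybe (Fin t)
    σ′ = Maybe.map h σ

    𝔅′ : Structure n s τ′
    𝔅′ = record { word = setW i σ (word 𝔄′) ; rel = rel 𝔄′ }

    𝔅 : Structure n t (τ P)
    𝔅 = record { word = setW i σ′ (word 𝔄) ; rel = rel 𝔄 }

    setW-≗ : Maybe.map h ∘ setW i σ (word 𝔄′) ≗ setW i σ′ (word 𝔄)
    setW-≗ j with j ≟ i
    ... | yes _ = refl
    ... | no  _ = word-≗ sim j

    Sat-pull : ∀ {Γ} (φ : Fm t (τ P) Γ) ρ → Sat 𝔅′ (pullUpd φ) ρ ⇔ Sat 𝔅 φ ρ
    Sat-pull = Sat-pullUpd 𝔅′ 𝔅 setW-≗ (rel-⇔ sim)

  foldl-Simulates : ∀ {n} {𝔄′ : Structure n s τ′} {𝔄 : Structure n t (τ P)} cs → Simulates 𝔄′ 𝔄 →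
                    Simulates (foldl (step pullback) 𝔄′ cs) (foldl (step P) 𝔄 (map pullChange cs))
  foldl-Simulates []       sim = sim
  foldl-Simulates (c ∷ cs) sim = foldl-Simulates cs (step-Simulates c sim)

  run-Simulates : ∀ {n} (cs : List (Fin n × Maybe (Fin s))) →
                  Simulates (run pullback cs) (run P (map pullChange cs))
  run-Simulates cs = foldl-Simulates cs initState-Simulates

wordOf-map : ∀ {n s t} (h : Fin s → Fin t) {w′ : Fin n → Maybe (Fin s)} {w : Fin n → Maybe (Fin t)} →
             Maybe.map h ∘ w′ ≗ w → wordOf w ≡ map h (wordOf w′)
wordOf-map h {w′} {w} w′≗w = begin
  catMaybes (tabulate w)                         ≡⟨ cong catMaybes (tabulate-cong (sym ∘ w′≗w)) ⟩
  catMaybes (tabulate (Maybe.map h ∘ w′))        ≡⟨ cong catMaybes (map-tabulate w′ (Maybe.map h)) ⟨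
  catMaybes (map (Maybe.map h) (tabulate w′))    ≡⟨ map-catMaybes h (tabulate w′) ⟨
  map h (catMaybes (tabulate w′))                ∎
  where open ≡-Reasoning

module Recognition {s} {L : List (Fin s) → Set} (M : FinMonoid)
  (A : DFA s) (recognizes : Recognizes A L) (h : Fin s → Fin (size M))
  (surjective : ∀ x → ∃ λ u → mprod M (map h u) ≡ x)
  (kernel : ∀ u v → (mprod M (map h u) ≡ mprod M (map h v)) ⇔ (∀ q → δ* A q u ≡ δ* A q v))
  where

  accepts : Fin (size M) → Bool
  accepts x = final A (δ* A (q₀ A) (proj₁ (surjective x)))

  accepts-mprod : ∀ w → accepts (mprod M (map h w)) ≡ final A (δ* A (q₀ A) w)
  accepts-mprod w = cong (final A) (Equivalence.to (kernel u w) mprod-u (q₀ A))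
    where
    u : List (Fin s)
    u = proj₁ (surjective (mprod M (map h w)))

    mprod-u : mprod M (map h u) ≡ mprod M (map h w)
    mprod-u = proj₂ (surjective (mprod M (map h w)))

  acceptingElements : List (Fin (size M))
  acceptingElements = filter (λ x → accepts x Bool.≟ true) (allFin (size M))

  ∈-acceptingElements : ∀ w → L w ⇔ mprod M (map h w) ∈ acceptingElements
  ∈-acceptingElements w = mk⇔
    (λ w∈L → ∈-filter⁺ (λ x → accepts x Bool.≟ true) (∈-allFin _)
                (trans (accepts-mprod w) (Equivalence.to (recognizes w) w∈L)))
    (λ hw∈F → Equivalence.from (recognizes w)
                (trans (sym (accepts-mprod w))
                       (proj₂ (∈-filter⁻ (λ x → accepts x Bool.≟ true) {xs = allFin (size M)} hw∈F))))

  module _ (P : DynProg (size M)) (acc : Fin (size M) → Fin (length (τ P)))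
           (acc-nullary : ∀ x → List.lookup (τ P) (acc x) ≡ 0)
           where

    acceptanceFlags : List (Nullary P)
    acceptanceFlags = map (λ x → acc x , acc-nullary x) acceptingElements

    open Pullback h P acceptanceFlags

    pullback-maintains :
      (∀ n cs x → holds0 (run P cs) (acc x) (acc-nullary x) ⇔ (mprod M (wordOf (word (run P cs))) ≡ x)) →
      MaintainsMemberLang pullback L
    pullback-maintains correct = Fin.zero , refl , flag⇔L
      where
      flag⇔L : ∀ n cs → holds0 (run pullback cs) Fin.zero refl ⇔ L (wordOf (word (run pullback cs)))
      flag⇔L n cs = begin
        holds0 (run pullback cs) Fin.zero refl                          ∼⟨ flag-⇔ sim ⟩
        Any (λ (r , p) → holds0 𝔄 r p) acceptanceFlags                  ↔⟨ map↔ ⟨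
        Any (λ x → holds0 𝔄 (acc x) (acc-nullary x)) acceptingElements  ∼⟨ Any-cong (correct n cs′) (⇔-id _) ⟩
        mprod M (wordOf (word 𝔄)) ∈ acceptingElements                   ≡⟨ cong (λ u → mprod M u ∈ acceptingElements)
                                                                                (wordOf-map h (word-≗ sim)) ⟩
        mprod M (map h w) ∈ acceptingElements                           ∼⟨ ⇔-sym (∈-acceptingElements w) ⟩
        L w                                                             ∎
        where
        open EquationalReasoning {k = equivalence}

        cs′ : List (Fin n × Maybe (Fin (size M)))
        cs′ = map pullChange cs

        𝔄 : Structure n (size M) (τ P)
        𝔄 = run P cs′

        sim : Simulates (run pullback cs) 𝔄
        sim = run-Simulates cs

        w : List (Fin s)
        w = wordOf (word (run pullback cs))

mainTheorem5 : (C : FormulaClass) → ClosedUnderDisjunction C → ClosedUnderTranslation C →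
               (k s : ℕ) (L : List (Fin s) → Set) (M : FinMonoid) →
               IsSyntacticMonoidOf M L → MemberMonoidInDyn C k M → MemberLangInDyn C k L
mainTheorem5 C C∨ Ctr k s L M (A , recognizes , _ , h , surjective , kernel)
             (P , P∈Dyn , acc , acc-nullary , correct) =
  pullback , pullback-inDyn C C∨ Ctr P∈Dyn , pullback-maintains P acc acc-nullary correct
  where
  open Recognition M A recognizes h surjective kernel
  open Pullback h P (acceptanceFlags P acc acc-nullary)
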